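{- For every $\Sigma$-sentence $\phi$ of $\mathcal{L}_{BT}$: if $\mathfrak{F}\models\phi$, then $F'\vdash\phi$.
   Context: Bit strings are elements of $\{\mathbf{0},\mathbf{1}\}^*$; $\varepsilon$ is the empty string, $|\alpha|$ the length. The language $\mathcal{L}_{BT}$ has constant symbols $e,0,1$, binary function symbol $\circ$ (also written as juxtaposition), and binary relation symbol $\sqsubseteq$. The structure $\mathfrak{F}$ has universe $\{\mathbf{0},\mathbf{1}\}^*$, interprets $e,0,1$ as $\varepsilon,\mathbf{0},\mathbf{1}$, $\circ$ as concatenation, and $\alpha\sqsubseteq\beta$ as $|\alpha|\le|\beta|$. $(\exists x\sqsubseteq t)\phi$ abbreviates $\exists x[x\sqsubseteq t\wedge\phi]$, $(\forall x\sqsubseteq t)\phi$ abbreviates $\forall x[x\sqsubseteq t\to\phi]$. $\Sigma$-formulas: $s\sqsubseteq t$, $\neg s\sqsubseteq t$, $s=t$, $\neg s=t$ (terms $s,t$) are $\Sigma$-formulas; they are closed under $\wedge,\vee$, and under $(\exists x\sqsubseteq t)$, $(\forall x\sqsubseteq t)$ and $\exists x$ where $x$ does not occur in $t$. Biterals: $\overline{\varepsilon}=e$, $\overline{\alpha\mathbf{0}}=\overline{\alpha}\circ 0$, $\overline{\alpha\mathbf{1}}=\overline{\alpha}\circ 1$. For $\alpha\in\{\mathbf{0},\mathbf{1}\}^*$ let $[\varepsilon\ldots\alpha]=\{\beta\in\{\mathbf{0},\mathbf{1}\}^*:|\beta|\le|\alpha|\}$. The theory $F'$ has the axioms: (1)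 $\forall x[x=ex\wedge x=xe]$; (2) $\forall xyz[(xy)z=x(yz)]$; (3) $\forall xy[x\neq y\to(x0\neq y0\wedge x1\neq y1)]$; (4) $\forall xy[x0\neq y1]$; (5) $\forall x[e\sqsubseteq x]$; (6) $\forall x[x\sqsubseteq e\to x=e]$; (7)–(10): for each $a,b\in\{0,1\}$, $\forall xy[xa\sqsubseteq yb\leftrightarrow x\sqsubseteq y]$; and, for every $\alpha\in\{\mathbf{0},\mathbf{1}\}^*$, the axiom $\forall x[x\sqsubseteq\overline{\alpha}\to\bigvee_{\beta\in[\varepsilon\ldots\alpha]}x=\overline{\beta}]$. -}

module Defs where

open import Data.Nat using (ℕ; zero; suc; _≤_)
open import Data.Fin using (Fin; zero; suc)
open import Data.Bool using (Bool; true; false)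
open import Data.List using (List; []; _∷_; foldl; map; length; concatMap; _++_)
open import Data.List.Membership.Propositional using (_∈_)
open import Data.Product using (_×_; Σ)
open import Data.Sum using (_⊎_)
open import Data.Empty using (⊥)
open import Relation.Binary.PropositionalEquality using (_≡_)

-- Bit strings: a bit string is a list of bits, false = 𝟎, true = 𝟏,
-- written left to right in list order.

BitString : Set
BitString = List Bool

infixl 7 _∘ₜ_
data Tm (n : ℕ) : Set where
  var  : Fin n → Tm n
  e    : Tm n
  c0   : Tm n
  c1   : Tm n
  _∘ₜ_ : Tm n → Tm n → Tm n

infix 5 _≐_ _⊑_
infixr 4 _∧̇_
infixr 3 _∨̇_
infixr 2 _⇒̇_
data Fm : ℕ → Set where
  ⊥̇   : ∀ {n} → Fm n
  _≐_ : ∀ {n} → Tm n → Tm n → Fm n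
  _⊑_ : ∀ {n} → Tm n → Tm n → Fm n
  _∧̇_ : ∀ {n} → Fm n → Fm n → Fm n
  _∨̇_ : ∀ {n} → Fm n → Fm n → Fm n
  _⇒̇_ : ∀ {n} → Fm n → Fm n → Fm n
  ∀̇   : ∀ {n} → Fm (suc n) → Fm n
  ∃̇   : ∀ {n} → Fm (suc n) → Fm n

¬̇_ : ∀ {n} → Fm n → Fm n
¬̇ φ = φ ⇒̇ ⊥̇

_⇔̇_ : ∀ {n} → Fm n → Fm n → Fm n
φ ⇔̇ ψ = (φ ⇒̇ ψ) ∧̇ (ψ ⇒̇ φ)

Sentence : Set
Sentence = Fm 0

liftR : ∀ {n m} → (Fin n → Fin m) → Fin (suc n) → Fin (suc m)
liftR ρ zero    = zero
liftR ρ (suc i) = suc (ρ i)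

renT : ∀ {n m} → (Fin n → Fin m) → Tm n → Tm m
renT ρ (var i)  = var (ρ i)
renT ρ e        = e
renT ρ c0       = c0
renT ρ c1       = c1
renT ρ (s ∘ₜ t) = renT ρ s ∘ₜ renT ρ t

renF : ∀ {n m} → (Fin n → Fin m) → Fm n → Fm m
renF ρ ⊥̇        = ⊥̇
renF ρ (s ≐ t)  = renT ρ s ≐ renT ρ t
renF ρ (s ⊑ t)  = renT ρ s ⊑ renT ρ t
renF ρ (φ ∧̇ ψ)  = renF ρ φ ∧̇ renF ρ ψ
renF ρ (φ ∨̇ ψ)  = renF ρ φ ∨̇ renF ρ ψ
renF ρ (φ ⇒̇ ψ)  = renF ρ φ ⇒̇ renF ρ ψ
renF ρ (∀̇ φ)    = ∀̇ (renF (liftR ρ) φ)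
renF ρ (∃̇ φ)    = ∃̇ (renF (liftR ρ) φ)

wkT : ∀ {n} → Tm n → Tm (suc n)
wkT = renT suc

wkF : ∀ {n} → Fm n → Fm (suc n)
wkF = renF suc

liftS : ∀ {n m} → (Fin n → Tm m) → Fin (suc n) → Tm (suc m)
liftS σ zero    = var zero
liftS σ (suc i) = wkT (σ i)

subT : ∀ {n m} → (Fin n → Tm m) → Tm n → Tm m
subT σ (var i)  = σ i
subT σ e        = e
subT σ c0       = c0
subT σ c1       = c1
subT σ (s ∘ₜ t) = subT σ s ∘ₜ subT σ t

subF : ∀ {n m} → (Fin n → Tm m) → Fm n → Fm m
subF σ ⊥̇        = ⊥̇
subF σ (s ≐ t)  = subT σ s ≐ subT σ t
subF σ (s ⊑ t)  = subT σ s ⊑ subT σ t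
subF σ (φ ∧̇ ψ)  = subF σ φ ∧̇ subF σ ψ
subF σ (φ ∨̇ ψ)  = subF σ φ ∨̇ subF σ ψ
subF σ (φ ⇒̇ ψ)  = subF σ φ ⇒̇ subF σ ψ
subF σ (∀̇ φ)    = ∀̇ (subF (liftS σ) φ)
subF σ (∃̇ φ)    = ∃̇ (subF (liftS σ) φ)

inst : ∀ {n} → Tm n → Fin (suc n) → Tm n
inst t zero    = t
inst t (suc i) = var i

_[_] : ∀ {n} → Fm (suc n) → Tm n → Fm n
φ [ t ] = subF (inst t) φ

closedT : ∀ {n} → Fin 0 → Fin n
closedT ()

embS : ∀ {n} → Sentence → Fm n
embS = renF closedT

-- Bounded quantifiers: (∃x⊑t)φ := ∃x[x⊑t ∧ φ], (∀x⊑t)φ := ∀x[x⊑t → φ].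
-- The bound term t lives in the outer context, so x cannot occur in t.

∃⊑ : ∀ {n} → Tm n → Fm (suc n) → Fm n
∃⊑ t φ = ∃̇ ((var zero ⊑ wkT t) ∧̇ φ)

∀⊑ : ∀ {n} → Tm n → Fm (suc n) → Fm n
∀⊑ t φ = ∀̇ ((var zero ⊑ wkT t) ⇒̇ φ)

data IsΣ : ∀ {n} → Fm n → Set where
  σ⊑   : ∀ {n} (s t : Tm n) → IsΣ (s ⊑ t)
  σ¬⊑  : ∀ {n} (s t : Tm n) → IsΣ (¬̇ (s ⊑ t))
  σ≐   : ∀ {n} (s t : Tm n) → IsΣ (s ≐ t)
  σ¬≐  : ∀ {n} (s t : Tm n) → IsΣ (¬̇ (s ≐ t))
  σ∧   : ∀ {n} {φ ψ : Fm n} → IsΣ φ → IsΣ ψ → IsΣ (φ ∧̇ ψ)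
  σ∨   : ∀ {n} {φ ψ : Fm n} → IsΣ φ → IsΣ ψ → IsΣ (φ ∨̇ ψ)
  σ∃⊑  : ∀ {n} (t : Tm n) {φ : Fm (suc n)} → IsΣ φ → IsΣ (∃⊑ t φ)
  σ∀⊑  : ∀ {n} (t : Tm n) {φ : Fm (suc n)} → IsΣ φ → IsΣ (∀⊑ t φ)
  σ∃   : ∀ {n} {φ : Fm (suc n)} → IsΣ φ → IsΣ (∃̇ φ)

bitC : ∀ {n} → Bool → Tm n
bitC false = c0
bitC true  = c1

Env : ℕ → Set
Env n = Fin n → BitString

_∷ₑ_ : ∀ {n} → BitString → Env n → Env (suc n)
(a ∷ₑ ρ) zero    = a
(a ∷ₑ ρ) (suc i) = ρ i

emptyEnv : Env 0
emptyEnv ()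

evalT : ∀ {n} → Env n → Tm n → BitString
evalT ρ (var i)  = ρ i
evalT ρ e        = []
evalT ρ c0       = false ∷ []
evalT ρ c1       = true ∷ []
evalT ρ (s ∘ₜ t) = evalT ρ s ++ evalT ρ t

Sat : ∀ {n} → Env n → Fm n → Set
Sat ρ ⊥̇       = ⊥
Sat ρ (s ≐ t) = evalT ρ s ≡ evalT ρ t
Sat ρ (s ⊑ t) = length (evalT ρ s) ≤ length (evalT ρ t)
Sat ρ (φ ∧̇ ψ) = Sat ρ φ × Sat ρ ψ
Sat ρ (φ ∨̇ ψ) = Sat ρ φ ⊎ Sat ρ ψ
Sat ρ (φ ⇒̇ ψ) = Sat ρ φ → Sat ρ ψ
Sat ρ (∀̇ φ)   = (a : BitString) → Sat (a ∷ₑ ρ) φ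
Sat ρ (∃̇ φ)   = Σ BitString (λ a → Sat (a ∷ₑ ρ) φ)

𝔉⊨_ : Sentence → Set
𝔉⊨ φ = Sat emptyEnv φ

biteral : ∀ {n} → BitString → Tm n
biteral α = foldl (λ t b → t ∘ₜ bitC b) e α

stringsOfLength : ℕ → List BitString
stringsOfLength zero    = [] ∷ []
stringsOfLength (suc k) = concatMap (λ β → (false ∷ β) ∷ (true ∷ β) ∷ []) (stringsOfLength k)

stringsUpTo : ℕ → List BitString
stringsUpTo zero    = stringsOfLength zero
stringsUpTo (suc k) = stringsUpTo k ++ stringsOfLength (suc k)

upTo : BitString → List BitString
upTo α = stringsUpTo (length α)

-- finite disjunction (never applied to the empty list below)
⋁ : ∀ {n} → List (Fm n) → Fm n
⋁ []           = ⊥̇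
⋁ (φ ∷ [])     = φ
⋁ (φ ∷ ψ ∷ φs) = φ ∨̇ ⋁ (ψ ∷ φs)

-- variables in a context of two / three variables (x outermost)
x₂ y₂ : Tm 2
x₂ = var (suc zero)
y₂ = var zero

x₃ y₃ z₃ : Tm 3
x₃ = var (suc (suc zero))
y₃ = var (suc zero)
z₃ = var zero

x₁ : Tm 1
x₁ = var zero

data AxF' : Sentence → Set where
  ax1  : AxF' (∀̇ ((x₁ ≐ (e ∘ₜ x₁)) ∧̇ (x₁ ≐ (x₁ ∘ₜ e))))
  ax2  : AxF' (∀̇ (∀̇ (∀̇ (((x₃ ∘ₜ y₃) ∘ₜ z₃) ≐ (x₃ ∘ₜ (y₃ ∘ₜ z₃))))))
  ax3  : AxF' (∀̇ (∀̇ ((¬̇ (x₂ ≐ y₂)) ⇒̇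
                     ((¬̇ ((x₂ ∘ₜ c0) ≐ (y₂ ∘ₜ c0))) ∧̇ (¬̇ ((x₂ ∘ₜ c1) ≐ (y₂ ∘ₜ c1)))))))
  ax4  : AxF' (∀̇ (∀̇ (¬̇ ((x₂ ∘ₜ c0) ≐ (y₂ ∘ₜ c1)))))
  ax5  : AxF' (∀̇ (e ⊑ x₁))
  ax6  : AxF' (∀̇ ((x₁ ⊑ e) ⇒̇ (x₁ ≐ e)))
  ax7-10 : (a b : Bool) →
         AxF' (∀̇ (∀̇ (((x₂ ∘ₜ bitC a) ⊑ (y₂ ∘ₜ bitC b)) ⇔̇ (x₂ ⊑ y₂))))
  axα  : (α : BitString) →
         AxF' (∀̇ ((x₁ ⊑ biteral α) ⇒̇ ⋁ (map (λ β → x₁ ≐ biteral β) (upTo α))))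

infix 1 _⨾_⊢_
data _⨾_⊢_ (Ax : Sentence → Set) : ∀ {n} → List (Fm n) → Fm n → Set where
  axiom : ∀ {n} {Γ : List (Fm n)} {ψ} → Ax ψ → Ax ⨾ Γ ⊢ embS ψ
  hyp   : ∀ {n} {Γ : List (Fm n)} {φ} → φ ∈ Γ → Ax ⨾ Γ ⊢ φ
  ⊥E    : ∀ {n} {Γ : List (Fm n)} {φ} → Ax ⨾ Γ ⊢ ⊥̇ → Ax ⨾ Γ ⊢ φ
  raa   : ∀ {n} {Γ : List (Fm n)} {φ} → Ax ⨾ (¬̇ φ) ∷ Γ ⊢ ⊥̇ → Ax ⨾ Γ ⊢ φ
  ⇒I    : ∀ {n} {Γ : List (Fm n)} {φ ψ} → Ax ⨾ φ ∷ Γ ⊢ ψ → Ax ⨾ Γ ⊢ φ ⇒̇ ψ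
  ⇒E    : ∀ {n} {Γ : List (Fm n)} {φ ψ} → Ax ⨾ Γ ⊢ φ ⇒̇ ψ → Ax ⨾ Γ ⊢ φ → Ax ⨾ Γ ⊢ ψ
  ∧I    : ∀ {n} {Γ : List (Fm n)} {φ ψ} → Ax ⨾ Γ ⊢ φ → Ax ⨾ Γ ⊢ ψ → Ax ⨾ Γ ⊢ φ ∧̇ ψ
  ∧E₁   : ∀ {n} {Γ : List (Fm n)} {φ ψ} → Ax ⨾ Γ ⊢ φ ∧̇ ψ → Ax ⨾ Γ ⊢ φ
  ∧E₂   : ∀ {n} {Γ : List (Fm n)} {φ ψ} → Ax ⨾ Γ ⊢ φ ∧̇ ψ → Ax ⨾ Γ ⊢ ψ
  ∨I₁   : ∀ {n} {Γ : List (Fm n)} {φ ψ} → Ax ⨾ Γ ⊢ φ → Ax ⨾ Γ ⊢ φ ∨̇ ψ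
  ∨I₂   : ∀ {n} {Γ : List (Fm n)} {φ ψ} → Ax ⨾ Γ ⊢ ψ → Ax ⨾ Γ ⊢ φ ∨̇ ψ
  ∨E    : ∀ {n} {Γ : List (Fm n)} {φ ψ χ} → Ax ⨾ Γ ⊢ φ ∨̇ ψ →
          Ax ⨾ φ ∷ Γ ⊢ χ → Ax ⨾ ψ ∷ Γ ⊢ χ → Ax ⨾ Γ ⊢ χ
  ∀I    : ∀ {n} {Γ : List (Fm n)} {φ} → Ax ⨾ map wkF Γ ⊢ φ → Ax ⨾ Γ ⊢ ∀̇ φ
  ∀E    : ∀ {n} {Γ : List (Fm n)} {φ} → Ax ⨾ Γ ⊢ ∀̇ φ → (t : Tm n) → Ax ⨾ Γ ⊢ φ [ t ]
  ∃I    : ∀ {n} {Γ : List (Fm n)} {φ} (t : Tm n) → Ax ⨾ Γ ⊢ φ [ t ] → Ax ⨾ Γ ⊢ ∃̇ φ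
  ∃E    : ∀ {n} {Γ : List (Fm n)} {φ ψ} → Ax ⨾ Γ ⊢ ∃̇ φ →
          Ax ⨾ φ ∷ map wkF Γ ⊢ wkF ψ → Ax ⨾ Γ ⊢ ψ
  ≐refl : ∀ {n} {Γ : List (Fm n)} (t : Tm n) → Ax ⨾ Γ ⊢ t ≐ t
  ≐subst : ∀ {n} {Γ : List (Fm n)} {s t} (φ : Fm (suc n)) →
          Ax ⨾ Γ ⊢ s ≐ t → Ax ⨾ Γ ⊢ φ [ s ] → Ax ⨾ Γ ⊢ φ [ t ]

F'⊢_ : Sentence → Set
F'⊢ φ = AxF' ⨾ [] ⊢ φ

-- Σ-completeness by induction on the Σ-formula, for all its closed instances
-- obtained by substituting biterals for the free variables.  F' proves every
-- closed term equal to the biteral of its value (axioms 1, 2), so atoms reduce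
-- to biterals, where true (in)equalities and length comparisons follow from
-- axioms 3–10 by recursion on the last bit.  ∧, ∨ and ∃ are immediate; a bounded
-- ∀ over a closed bound with value α is reduced by the axiom for α to the
-- finitely many instances x = β̄ with |β| ≤ |α|, each true and hence provable.

module Submission where

open import Defs
open import Data.Nat using (ℕ; zero; suc; _≤_; _<_; z≤n; s≤s)
open import Data.Nat.Properties using (≤-reflexive; m≤n⇒m≤1+n; ≰⇒>)
open import Data.Fin using (Fin; zero; suc)
open import Data.Bool using (Bool; true; false)
open import Data.List using (List; []; _∷_; foldl; map; length; _++_; reverse; _∷ʳ_)
open import Data.List.Properties using (foldl-++; unfold-reverse; length-reverse; reverse-injective)
open import Data.List.Membership.Propositional using (_∈_)
open import Data.List.Relation.Unary.Any using (here; there)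
open import Data.List.Relation.Unary.All as All using (All; []; _∷_)
open import Data.List.Relation.Unary.All.Properties using (++⁺; concat⁺; map⁺)
open import Data.Product using (_,_)
open import Data.Sum using (inj₁; inj₂)
open import Data.Empty using (⊥-elim)
open import Function using (_∘_)
open import Relation.Binary.PropositionalEquality hiding ([_])
open ≡-Reasoning

infix 1 _⊩_
_⊩_ : ∀ {n} → List (Fm n) → Fm n → Set
Γ ⊩ φ = AxF' ⨾ Γ ⊢ φ

cast : ∀ {n} {Γ : List (Fm n)} {φ ψ} → φ ≡ ψ → Γ ⊩ φ → Γ ⊩ ψ
cast refl p = p

infixr 5 _∷ₛ_
_∷ₛ_ : ∀ {n m} → Tm m → (Fin n → Tm m) → Fin (suc n) → Tm m
(t ∷ₛ σ) zero    = t
(t ∷ₛ σ) (suc i) = σ i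

∅ₛ : ∀ {m} → Fin 0 → Tm m
∅ₛ ()

subT-cong : ∀ {n m} {σ σ' : Fin n → Tm m} → (∀ i → σ i ≡ σ' i) → ∀ t → subT σ t ≡ subT σ' t
subT-cong h (var i)  = h i
subT-cong h e        = refl
subT-cong h c0       = refl
subT-cong h c1       = refl
subT-cong h (s ∘ₜ t) = cong₂ _∘ₜ_ (subT-cong h s) (subT-cong h t)

subT-renT : ∀ {n m k} (σ : Fin m → Tm k) (ρ : Fin n → Fin m) t →
            subT σ (renT ρ t) ≡ subT (σ ∘ ρ) t
subT-renT σ ρ (var i)  = refl
subT-renT σ ρ e        = refl
subT-renT σ ρ c0       = refl
subT-renT σ ρ c1       = refl
subT-renT σ ρ (s ∘ₜ t) = cong₂ _∘ₜ_ (subT-renT σ ρ s) (subT-renT σ ρ t)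

renT-subT : ∀ {n m k} (ρ : Fin m → Fin k) (σ : Fin n → Tm m) t →
            renT ρ (subT σ t) ≡ subT (renT ρ ∘ σ) t
renT-subT ρ σ (var i)  = refl
renT-subT ρ σ e        = refl
renT-subT ρ σ c0       = refl
renT-subT ρ σ c1       = refl
renT-subT ρ σ (s ∘ₜ t) = cong₂ _∘ₜ_ (renT-subT ρ σ s) (renT-subT ρ σ t)

subT-subT : ∀ {n m k} (σ : Fin m → Tm k) (τ : Fin n → Tm m) t →
            subT σ (subT τ t) ≡ subT (subT σ ∘ τ) t
subT-subT σ τ (var i)  = refl
subT-subT σ τ e        = refl
subT-subT σ τ c0       = refl
subT-subT σ τ c1       = refl
subT-subT σ τ (s ∘ₜ t) = cong₂ _∘ₜ_ (subT-subT σ τ s) (subT-subT σ τ t)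

subT-var : ∀ {n} (t : Tm n) → subT var t ≡ t
subT-var (var i)  = refl
subT-var e        = refl
subT-var c0       = refl
subT-var c1       = refl
subT-var (s ∘ₜ t) = cong₂ _∘ₜ_ (subT-var s) (subT-var t)

renT≡subT : ∀ {n m} (ρ : Fin n → Fin m) t → renT ρ t ≡ subT (var ∘ ρ) t
renT≡subT ρ (var i)  = refl
renT≡subT ρ e        = refl
renT≡subT ρ c0       = refl
renT≡subT ρ c1       = refl
renT≡subT ρ (s ∘ₜ t) = cong₂ _∘ₜ_ (renT≡subT ρ s) (renT≡subT ρ t)

subT-inst-wkT : ∀ {n} (u t : Tm n) → subT (inst u) (wkT t) ≡ t
subT-inst-wkT u t = trans (subT-renT (inst u) suc t) (subT-var t)

liftS-cong : ∀ {n m} {σ σ' : Fin n → Tm m} → (∀ i → σ i ≡ σ' i) → ∀ i → liftS σ i ≡ liftS σ' i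
liftS-cong h zero    = refl
liftS-cong h (suc i) = cong wkT (h i)

subF-cong : ∀ {n m} {σ σ' : Fin n → Tm m} → (∀ i → σ i ≡ σ' i) → ∀ φ → subF σ φ ≡ subF σ' φ
subF-cong h ⊥̇       = refl
subF-cong h (s ≐ t) = cong₂ _≐_ (subT-cong h s) (subT-cong h t)
subF-cong h (s ⊑ t) = cong₂ _⊑_ (subT-cong h s) (subT-cong h t)
subF-cong h (φ ∧̇ ψ) = cong₂ _∧̇_ (subF-cong h φ) (subF-cong h ψ)
subF-cong h (φ ∨̇ ψ) = cong₂ _∨̇_ (subF-cong h φ) (subF-cong h ψ)
subF-cong h (φ ⇒̇ ψ) = cong₂ _⇒̇_ (subF-cong h φ) (subF-cong h ψ)
subF-cong h (∀̇ φ)   = cong ∀̇ (subF-cong (liftS-cong h) φ)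
subF-cong h (∃̇ φ)   = cong ∃̇ (subF-cong (liftS-cong h) φ)

subT-liftS : ∀ {n m k} (σ : Fin m → Tm k) (τ : Fin n → Tm m) i →
             subT (liftS σ) (liftS τ i) ≡ liftS (subT σ ∘ τ) i
subT-liftS σ τ zero    = refl
subT-liftS σ τ (suc i) = trans (subT-renT (liftS σ) suc (τ i)) (sym (renT-subT suc σ (τ i)))

subF-subF : ∀ {n m k} (σ : Fin m → Tm k) (τ : Fin n → Tm m) φ →
            subF σ (subF τ φ) ≡ subF (subT σ ∘ τ) φ
subF-subF σ τ ⊥̇       = refl
subF-subF σ τ (s ≐ t) = cong₂ _≐_ (subT-subT σ τ s) (subT-subT σ τ t)
subF-subF σ τ (s ⊑ t) = cong₂ _⊑_ (subT-subT σ τ s) (subT-subT σ τ t)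
subF-subF σ τ (φ ∧̇ ψ) = cong₂ _∧̇_ (subF-subF σ τ φ) (subF-subF σ τ ψ)
subF-subF σ τ (φ ∨̇ ψ) = cong₂ _∨̇_ (subF-subF σ τ φ) (subF-subF σ τ ψ)
subF-subF σ τ (φ ⇒̇ ψ) = cong₂ _⇒̇_ (subF-subF σ τ φ) (subF-subF σ τ ψ)
subF-subF σ τ (∀̇ φ)   = cong ∀̇ (trans (subF-subF (liftS σ) (liftS τ) φ) (subF-cong (subT-liftS σ τ) φ))
subF-subF σ τ (∃̇ φ)   = cong ∃̇ (trans (subF-subF (liftS σ) (liftS τ) φ) (subF-cong (subT-liftS σ τ) φ))

liftS-var : ∀ {n m} (ρ : Fin n → Fin m) i → liftS (var ∘ ρ) i ≡ var (liftR ρ i)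
liftS-var ρ zero    = refl
liftS-var ρ (suc i) = refl

renF≡subF : ∀ {n m} (ρ : Fin n → Fin m) φ → renF ρ φ ≡ subF (var ∘ ρ) φ
renF≡subF ρ ⊥̇       = refl
renF≡subF ρ (s ≐ t) = cong₂ _≐_ (renT≡subT ρ s) (renT≡subT ρ t)
renF≡subF ρ (s ⊑ t) = cong₂ _⊑_ (renT≡subT ρ s) (renT≡subT ρ t)
renF≡subF ρ (φ ∧̇ ψ) = cong₂ _∧̇_ (renF≡subF ρ φ) (renF≡subF ρ ψ)
renF≡subF ρ (φ ∨̇ ψ) = cong₂ _∨̇_ (renF≡subF ρ φ) (renF≡subF ρ ψ)
renF≡subF ρ (φ ⇒̇ ψ) = cong₂ _⇒̇_ (renF≡subF ρ φ) (renF≡subF ρ ψ)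
renF≡subF ρ (∀̇ φ)   = cong ∀̇ (trans (renF≡subF (liftR ρ) φ) (sym (subF-cong (liftS-var ρ) φ)))
renF≡subF ρ (∃̇ φ)   = cong ∃̇ (trans (renF≡subF (liftR ρ) φ) (sym (subF-cong (liftS-var ρ) φ)))

liftS-id : ∀ {n} {σ : Fin n → Tm n} → (∀ i → σ i ≡ var i) → ∀ i → liftS σ i ≡ var i
liftS-id h zero    = refl
liftS-id h (suc i) = cong wkT (h i)

subF-id : ∀ {n} {σ : Fin n → Tm n} → (∀ i → σ i ≡ var i) → ∀ φ → subF σ φ ≡ φ
subF-id h ⊥̇       = refl
subF-id h (s ≐ t) = cong₂ _≐_ (trans (subT-cong h s) (subT-var s)) (trans (subT-cong h t) (subT-var t))
subF-id h (s ⊑ t) = cong₂ _⊑_ (trans (subT-cong h s) (subT-var s)) (trans (subT-cong h t) (subT-var t))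
subF-id h (φ ∧̇ ψ) = cong₂ _∧̇_ (subF-id h φ) (subF-id h ψ)
subF-id h (φ ∨̇ ψ) = cong₂ _∨̇_ (subF-id h φ) (subF-id h ψ)
subF-id h (φ ⇒̇ ψ) = cong₂ _⇒̇_ (subF-id h φ) (subF-id h ψ)
subF-id h (∀̇ φ)   = cong ∀̇ (subF-id (liftS-id h) φ)
subF-id h (∃̇ φ)   = cong ∃̇ (subF-id (liftS-id h) φ)

subF-liftS-inst : ∀ {n m} (σ : Fin n → Tm m) u φ → subF (liftS σ) φ [ u ] ≡ subF (u ∷ₛ σ) φ
subF-liftS-inst σ u φ = trans (subF-subF (inst u) (liftS σ) φ) (subF-cong pointwise φ)
  where
  pointwise : ∀ i → subT (inst u) (liftS σ i) ≡ (u ∷ₛ σ) i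
  pointwise zero    = refl
  pointwise (suc i) = subT-inst-wkT u (σ i)

module _ {n : ℕ} {Γ : List (Fm n)} where

  ≐subst-≡ : ∀ {s t ψ χ} (φ : Fm (suc n)) → φ [ s ] ≡ ψ → φ [ t ] ≡ χ →
             Γ ⊩ s ≐ t → Γ ⊩ ψ → Γ ⊩ χ
  ≐subst-≡ φ refl refl = ≐subst φ

  ≡⇒≐ : ∀ {s t} → s ≡ t → Γ ⊩ s ≐ t
  ≡⇒≐ {s} refl = ≐refl s

  ≐sym : ∀ {s t} → Γ ⊩ s ≐ t → Γ ⊩ t ≐ s
  ≐sym {s} {t} p = ≐subst-≡ (var zero ≐ wkT s)
    (cong (s ≐_) (subT-inst-wkT s s)) (cong (t ≐_) (subT-inst-wkT t s)) p (≐refl s)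

  ≐trans : ∀ {s t u} → Γ ⊩ s ≐ t → Γ ⊩ t ≐ u → Γ ⊩ s ≐ u
  ≐trans {s} {t} {u} p q = ≐subst-≡ (wkT s ≐ var zero)
    (cong (_≐ t) (subT-inst-wkT t s)) (cong (_≐ u) (subT-inst-wkT u s)) q p

  ≐cong : ∀ {s t} (C : Tm (suc n)) → Γ ⊩ s ≐ t → Γ ⊩ subT (inst s) C ≐ subT (inst t) C
  ≐cong {s} {t} C p = ≐subst-≡ (wkT Cs ≐ C)
    (cong (_≐ Cs) (subT-inst-wkT s Cs)) (cong (_≐ subT (inst t) C) (subT-inst-wkT t Cs)) p (≐refl Cs)
    where Cs = subT (inst s) C

  ∘-congˡ : ∀ {s s'} u → Γ ⊩ s ≐ s' → Γ ⊩ s ∘ₜ u ≐ s' ∘ₜ u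
  ∘-congˡ {s} {s'} u p = cast (cong₂ (λ a b → s ∘ₜ a ≐ s' ∘ₜ b) (subT-inst-wkT s u) (subT-inst-wkT s' u))
    (≐cong (var zero ∘ₜ wkT u) p)

  ∘-congʳ : ∀ {s s'} u → Γ ⊩ s ≐ s' → Γ ⊩ u ∘ₜ s ≐ u ∘ₜ s'
  ∘-congʳ {s} {s'} u p = cast (cong₂ (λ a b → a ∘ₜ s ≐ b ∘ₜ s') (subT-inst-wkT s u) (subT-inst-wkT s' u))
    (≐cong (wkT u ∘ₜ var zero) p)

  ⊑-congˡ : ∀ {s s' t} → Γ ⊩ s ≐ s' → Γ ⊩ s ⊑ t → Γ ⊩ s' ⊑ t
  ⊑-congˡ {s} {s'} {t} = ≐subst-≡ (var zero ⊑ wkT t)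
    (cong (s ⊑_) (subT-inst-wkT s t)) (cong (s' ⊑_) (subT-inst-wkT s' t))

  ⊑-congʳ : ∀ {s t t'} → Γ ⊩ t ≐ t' → Γ ⊩ s ⊑ t → Γ ⊩ s ⊑ t'
  ⊑-congʳ {s} {t} {t'} = ≐subst-≡ (wkT s ⊑ var zero)
    (cong (_⊑ t) (subT-inst-wkT t s)) (cong (_⊑ t') (subT-inst-wkT t' s))

  ⊑-cong : ∀ {s s' t t'} → Γ ⊩ s ≐ s' → Γ ⊩ t ≐ t' → Γ ⊩ s ⊑ t → Γ ⊩ s' ⊑ t'
  ⊑-cong p q = ⊑-congʳ q ∘ ⊑-congˡ p

  ∀E-sub : ∀ {k} {σ : Fin k → Tm n} {φ} → Γ ⊩ subF σ (∀̇ φ) → ∀ u → Γ ⊩ subF (u ∷ₛ σ) φ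
  ∀E-sub {σ = σ} {φ} p u = cast (subF-liftS-inst σ u φ) (∀E p u)

  axiom-sub : ∀ {ψ} → AxF' ψ → Γ ⊩ subF ∅ₛ ψ
  axiom-sub {ψ} a = cast (trans (renF≡subF closedT ψ) (subF-cong (λ ()) ψ)) (axiom a)

  axiom∀ : ∀ {φ} → AxF' (∀̇ φ) → ∀ t → Γ ⊩ subF (t ∷ₛ ∅ₛ) φ
  axiom∀ {φ} a = ∀E-sub {σ = ∅ₛ} {φ} (axiom-sub a)

  axiom∀∀ : ∀ {φ} → AxF' (∀̇ (∀̇ φ)) → ∀ t u → Γ ⊩ subF (u ∷ₛ t ∷ₛ ∅ₛ) φ
  axiom∀∀ {φ} a t = ∀E-sub {σ = t ∷ₛ ∅ₛ} {φ} (axiom∀ a t)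

  axiom∀∀∀ : ∀ {φ} → AxF' (∀̇ (∀̇ (∀̇ φ))) → ∀ s t u → Γ ⊩ subF (u ∷ₛ t ∷ₛ s ∷ₛ ∅ₛ) φ
  axiom∀∀∀ {φ} a s t = ∀E-sub {σ = t ∷ₛ s ∷ₛ ∅ₛ} {φ} (axiom∀∀ a s t)

  e-identityˡ : ∀ t → Γ ⊩ t ≐ e ∘ₜ t
  e-identityˡ t = ∧E₁ (axiom∀ ax1 t)

  e-identityʳ : ∀ t → Γ ⊩ t ≐ t ∘ₜ e
  e-identityʳ t = ∧E₂ (axiom∀ ax1 t)

  ∘-assoc : ∀ s t u → Γ ⊩ (s ∘ₜ t) ∘ₜ u ≐ s ∘ₜ (t ∘ₜ u)
  ∘-assoc = axiom∀∀∀ ax2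

  ∘bit-≢ : ∀ b {t u} → Γ ⊩ ¬̇ (t ≐ u) → Γ ⊩ ¬̇ (t ∘ₜ bitC b ≐ u ∘ₜ bitC b)
  ∘bit-≢ false {t} {u} p = ∧E₁ (⇒E (axiom∀∀ ax3 t u) p)
  ∘bit-≢ true  {t} {u} p = ∧E₂ (⇒E (axiom∀∀ ax3 t u) p)

  ∘0≢∘1 : ∀ t u → Γ ⊩ ¬̇ (t ∘ₜ c0 ≐ u ∘ₜ c1)
  ∘0≢∘1 = axiom∀∀ ax4

  e-least : ∀ t → Γ ⊩ e ⊑ t
  e-least = axiom∀ ax5

  ⊑e⇒≐e : ∀ t → Γ ⊩ (t ⊑ e) ⇒̇ (t ≐ e)
  ⊑e⇒≐e = axiom∀ ax6

  ∘bit-⊑⇔⊑ : ∀ a b t u → Γ ⊩ (t ∘ₜ bitC a ⊑ u ∘ₜ bitC b) ⇔̇ (t ⊑ u)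
  ∘bit-⊑⇔⊑ false false = axiom∀∀ (ax7-10 false false)
  ∘bit-⊑⇔⊑ false true  = axiom∀∀ (ax7-10 false true)
  ∘bit-⊑⇔⊑ true  false = axiom∀∀ (ax7-10 true false)
  ∘bit-⊑⇔⊑ true  true  = axiom∀∀ (ax7-10 true true)

-- t ∘ʳ xs appends the bits of xs to t in reverse order, so that the last
-- bit of a biteral becomes the head of the list: biteral α ≡ biteralʳ (reverse α).
infixl 7 _∘ʳ_
_∘ʳ_ : ∀ {n} → Tm n → List Bool → Tm n
t ∘ʳ []       = t
t ∘ʳ (b ∷ xs) = (t ∘ʳ xs) ∘ₜ bitC b

biteralʳ : ∀ {n} → List Bool → Tm n
biteralʳ xs = e ∘ʳ xs

∘ʳ-∷ʳ : ∀ {n} (t : Tm n) xs b → t ∘ʳ (xs ∷ʳ b) ≡ (t ∘ₜ bitC b) ∘ʳ xs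
∘ʳ-∷ʳ t []       b = refl
∘ʳ-∷ʳ t (x ∷ xs) b = cong (_∘ₜ bitC x) (∘ʳ-∷ʳ t xs b)

foldl≡∘ʳ-reverse : ∀ {n} (t : Tm n) α → foldl (λ s b → s ∘ₜ bitC b) t α ≡ t ∘ʳ reverse α
foldl≡∘ʳ-reverse t []      = refl
foldl≡∘ʳ-reverse t (b ∷ α) = begin
  foldl (λ s b → s ∘ₜ bitC b) (t ∘ₜ bitC b) α  ≡⟨ foldl≡∘ʳ-reverse (t ∘ₜ bitC b) α ⟩
  (t ∘ₜ bitC b) ∘ʳ reverse α                   ≡⟨ ∘ʳ-∷ʳ t (reverse α) b ⟨
  t ∘ʳ (reverse α ∷ʳ b)                        ≡⟨ cong (t ∘ʳ_) (unfold-reverse b α) ⟨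
  t ∘ʳ reverse (b ∷ α)                         ∎

biteral≡biteralʳ : ∀ {n} α → biteral {n} α ≡ biteralʳ (reverse α)
biteral≡biteralʳ = foldl≡∘ʳ-reverse e

subT-bitC : ∀ {n m} (σ : Fin n → Tm m) b → subT σ (bitC b) ≡ bitC b
subT-bitC σ false = refl
subT-bitC σ true  = refl

subT-biteralʳ : ∀ {n m} (σ : Fin n → Tm m) xs → subT σ (biteralʳ xs) ≡ biteralʳ xs
subT-biteralʳ σ []       = refl
subT-biteralʳ σ (b ∷ xs) = cong₂ _∘ₜ_ (subT-biteralʳ σ xs) (subT-bitC σ b)

subT-biteral : ∀ {n m} (σ : Fin n → Tm m) α → subT σ (biteral α) ≡ biteral α
subT-biteral σ α = begin
  subT σ (biteral α)                ≡⟨ cong (subT σ) (biteral≡biteralʳ α) ⟩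
  subT σ (biteralʳ (reverse α))     ≡⟨ subT-biteralʳ σ (reverse α) ⟩
  biteralʳ (reverse α)              ≡⟨ biteral≡biteralʳ α ⟨
  biteral α                         ∎

renT-biteral : ∀ {n m} (ρ : Fin n → Fin m) α → renT ρ (biteral α) ≡ biteral α
renT-biteral ρ α = trans (renT≡subT ρ (biteral α)) (subT-biteral (var ∘ ρ) α)

∘ʳ≐∘biteralʳ : ∀ {n} {Γ : List (Fm n)} t xs → Γ ⊩ t ∘ʳ xs ≐ t ∘ₜ biteralʳ xs
∘ʳ≐∘biteralʳ t []       = e-identityʳ t
∘ʳ≐∘biteralʳ t (b ∷ xs) =
  ≐trans (∘-congˡ (bitC b) (∘ʳ≐∘biteralʳ t xs)) (∘-assoc t (biteralʳ xs) (bitC b))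

biteral-++ : ∀ {n} {Γ : List (Fm n)} α β → Γ ⊩ biteral (α ++ β) ≐ biteral α ∘ₜ biteral β
biteral-++ α β = cast (cong₂ _≐_ unfolded (cong (biteral α ∘ₜ_) (sym (biteral≡biteralʳ β))))
  (∘ʳ≐∘biteralʳ (biteral α) (reverse β))
  where
  unfolded : biteral α ∘ʳ reverse β ≡ biteral (α ++ β)
  unfolded = trans (sym (foldl≡∘ʳ-reverse (biteral α) β)) (sym (foldl-++ _ e α β))

e≐∘-prefix : ∀ {n} {Γ : List (Fm n)} {t u} → Γ ⊩ e ≐ t ∘ₜ u → ∀ c → Γ ⊩ e ∘ₜ c ≐ (c ∘ₜ t) ∘ₜ u
e≐∘-prefix {t = t} {u} p c =
  ≐trans (≐sym (e-identityˡ c)) (≐trans (e-identityʳ c) (≐trans (∘-congʳ c p) (≐sym (∘-assoc c t u))))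

-- Prefixing the other bit turns ε = t b into a clash of last bits, refuted by axiom (4).
e≢∘bit : ∀ {n} {Γ : List (Fm n)} {t} b → Γ ⊩ e ≐ t ∘ₜ bitC b → Γ ⊩ ⊥̇
e≢∘bit false p = ⇒E (∘0≢∘1 _ e) (≐sym (e≐∘-prefix p c1))
e≢∘bit true  p = ⇒E (∘0≢∘1 e _) (e≐∘-prefix p c0)

biteralʳ-≢ : ∀ {n} {Γ : List (Fm n)} xs ys → xs ≢ ys → Γ ⊩ biteralʳ xs ≐ biteralʳ ys → Γ ⊩ ⊥̇
biteralʳ-≢ []           []           xs≢ys _ = ⊥-elim (xs≢ys refl)
biteralʳ-≢ []           (b ∷ ys)     _     p = e≢∘bit b p
biteralʳ-≢ (a ∷ xs)     []           _     p = e≢∘bit a (≐sym p)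
biteralʳ-≢ (false ∷ xs) (true ∷ ys)  _     p = ⇒E (∘0≢∘1 _ _) p
biteralʳ-≢ (true ∷ xs)  (false ∷ ys) _     p = ⇒E (∘0≢∘1 _ _) (≐sym p)
biteralʳ-≢ (false ∷ xs) (false ∷ ys) xs≢ys p =
  ⇒E (∘bit-≢ false (⇒I (biteralʳ-≢ xs ys (xs≢ys ∘ cong (false ∷_)) (hyp (here refl))))) p
biteralʳ-≢ (true ∷ xs)  (true ∷ ys)  xs≢ys p =
  ⇒E (∘bit-≢ true (⇒I (biteralʳ-≢ xs ys (xs≢ys ∘ cong (true ∷_)) (hyp (here refl))))) p

biteralʳ-⊑ : ∀ {n} {Γ : List (Fm n)} xs ys → length xs ≤ length ys → Γ ⊩ biteralʳ xs ⊑ biteralʳ ys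
biteralʳ-⊑ []       ys       _        = e-least _
biteralʳ-⊑ (a ∷ xs) (b ∷ ys) (s≤s le) = ⇒E (∧E₂ (∘bit-⊑⇔⊑ a b _ _)) (biteralʳ-⊑ xs ys le)

biteralʳ-⋢ : ∀ {n} {Γ : List (Fm n)} xs ys → length ys < length xs →
             Γ ⊩ biteralʳ xs ⊑ biteralʳ ys → Γ ⊩ ⊥̇
biteralʳ-⋢ (a ∷ xs) []       _        p = e≢∘bit a (≐sym (⇒E (⊑e⇒≐e _) p))
biteralʳ-⋢ (a ∷ xs) (b ∷ ys) (s≤s lt) p = biteralʳ-⋢ xs ys lt (⇒E (∧E₁ (∘bit-⊑⇔⊑ a b _ _)) p)

module _ {n : ℕ} {Γ : List (Fm n)} (α β : BitString) where

  biteral-≢ : α ≢ β → Γ ⊩ biteral α ≐ biteral β → Γ ⊩ ⊥̇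
  biteral-≢ α≢β rewrite biteral≡biteralʳ {n} α | biteral≡biteralʳ {n} β =
    biteralʳ-≢ (reverse α) (reverse β) (α≢β ∘ reverse-injective)

  biteral-⊑ : length α ≤ length β → Γ ⊩ biteral α ⊑ biteral β
  biteral-⊑ le rewrite biteral≡biteralʳ {n} α | biteral≡biteralʳ {n} β =
    biteralʳ-⊑ (reverse α) (reverse β) (subst₂ _≤_ (sym (length-reverse α)) (sym (length-reverse β)) le)

  biteral-⋢ : length β < length α → Γ ⊩ biteral α ⊑ biteral β → Γ ⊩ ⊥̇
  biteral-⋢ lt rewrite biteral≡biteralʳ {n} α | biteral≡biteralʳ {n} β =
    biteralʳ-⋢ (reverse α) (reverse β) (subst₂ _<_ (sym (length-reverse β)) (sym (length-reverse α)) lt)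

⌜_⌝ : ∀ {n m} → Env n → Fin n → Tm m
⌜ ρ ⌝ i = biteral (ρ i)

subT⌜⌝≐evalT : ∀ {n m} {Γ : List (Fm m)} (ρ : Env n) t → Γ ⊩ subT ⌜ ρ ⌝ t ≐ biteral (evalT ρ t)
subT⌜⌝≐evalT ρ (var i)  = ≐refl _
subT⌜⌝≐evalT ρ e        = ≐refl e
subT⌜⌝≐evalT ρ c0       = e-identityˡ c0
subT⌜⌝≐evalT ρ c1       = e-identityˡ c1
subT⌜⌝≐evalT ρ (s ∘ₜ t) =
  ≐trans (∘-congˡ _ (subT⌜⌝≐evalT ρ s))
  (≐trans (∘-congʳ _ (subT⌜⌝≐evalT ρ t)) (≐sym (biteral-++ (evalT ρ s) (evalT ρ t))))

⊑-complete : ∀ {n m} {Γ : List (Fm m)} (s t : Tm n) (ρ : Env n) → Sat ρ (s ⊑ t) → Γ ⊩ subF ⌜ ρ ⌝ (s ⊑ t)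
⊑-complete s t ρ le =
  ⊑-cong (≐sym (subT⌜⌝≐evalT ρ s)) (≐sym (subT⌜⌝≐evalT ρ t)) (biteral-⊑ (evalT ρ s) (evalT ρ t) le)

subF-⌜∷ₑ⌝ : ∀ {n m} a (ρ : Env n) φ → subF ⌜ a ∷ₑ ρ ⌝ φ ≡ subF {m = m} (biteral a ∷ₛ ⌜ ρ ⌝) φ
subF-⌜∷ₑ⌝ a ρ = subF-cong λ { zero → refl ; (suc i) → refl }

∃-intro : ∀ {n m} {Γ : List (Fm m)} (ρ : Env n) a φ → Γ ⊩ subF ⌜ a ∷ₑ ρ ⌝ φ → Γ ⊩ subF ⌜ ρ ⌝ (∃̇ φ)
∃-intro ρ a φ p =
  ∃I (biteral a) (cast (trans (subF-⌜∷ₑ⌝ a ρ φ) (sym (subF-liftS-inst ⌜ ρ ⌝ (biteral a) φ))) p)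

subF-⋁≐biteral : ∀ {k} (σ : Fin 1 → Tm k) βs →
  subF σ (⋁ (map (λ β → x₁ ≐ biteral β) βs)) ≡ ⋁ (map (λ β → σ zero ≐ biteral β) βs)
subF-⋁≐biteral σ []           = refl
subF-⋁≐biteral σ (β ∷ [])     = cong (σ zero ≐_) (subT-biteral σ β)
subF-⋁≐biteral σ (β ∷ γ ∷ βs) = cong₂ _∨̇_ (cong (σ zero ≐_) (subT-biteral σ β)) (subF-⋁≐biteral σ (γ ∷ βs))

⊑biteral⇒⋁≐ : ∀ {n} {Γ : List (Fm n)} α t →
  Γ ⊩ (t ⊑ biteral α) ⇒̇ ⋁ (map (λ β → t ≐ biteral β) (upTo α))
⊑biteral⇒⋁≐ α t =
  cast (cong₂ (λ b d → (t ⊑ b) ⇒̇ d) (subT-biteral _ α) (subF-⋁≐biteral _ (upTo α))) (axiom∀ (axα α) t)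

⋁-elim : ∀ {n} {Γ : List (Fm n)} {χ} {A : Set} (f : A → Fm n) xs →
         (∀ {x} → x ∈ xs → ∀ {Δ} → Δ ⊩ f x → Δ ⊩ χ) → Γ ⊩ ⋁ (map f xs) → Γ ⊩ χ
⋁-elim f []           _      p = ⊥E p
⋁-elim f (x ∷ [])     branch p = branch (here refl) p
⋁-elim f (x ∷ y ∷ xs) branch p =
  ∨E p (branch (here refl) (hyp (here refl))) (⋁-elim f (y ∷ xs) (branch ∘ there) (hyp (here refl)))

stringsOfLength-length : ∀ k → All (λ β → length β ≡ k) (stringsOfLength k)
stringsOfLength-length zero    = refl ∷ []
stringsOfLength-length (suc k) =
  concat⁺ (map⁺ (All.map (λ p → cong suc p ∷ cong suc p ∷ []) (stringsOfLength-length k)))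

stringsUpTo-length : ∀ k → All (λ β → length β ≤ k) (stringsUpTo k)
stringsUpTo-length zero    = z≤n ∷ []
stringsUpTo-length (suc k) =
  ++⁺ (All.map m≤n⇒m≤1+n (stringsUpTo-length k)) (All.map ≤-reflexive (stringsOfLength-length (suc k)))

∈upTo⇒length≤ : ∀ α {β} → β ∈ upTo α → length β ≤ length α
∈upTo⇒length≤ α = All.lookup (stringsUpTo-length (length α))

liftS-⌜⌝ : ∀ {n m} (ρ : Env n) i → (var zero ∷ₛ ⌜ ρ ⌝) i ≡ liftS {m = m} ⌜ ρ ⌝ i
liftS-⌜⌝ ρ zero    = refl
liftS-⌜⌝ ρ (suc i) = sym (renT-biteral suc (ρ i))

∀⊑-intro : ∀ {n m} {Γ : List (Fm m)} (ρ : Env n) t φ →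
  (∀ β → length β ≤ length (evalT ρ t) → ∀ {Δ : List (Fm (suc m))} → Δ ⊩ subF ⌜ β ∷ₑ ρ ⌝ φ) →
  Γ ⊩ subF ⌜ ρ ⌝ (∀⊑ t φ)
∀⊑-intro {m = m} {Γ} ρ t φ instances = ∀I (⇒I (⋁-elim _ (upTo α) branch x-cases))
  where
  α = evalT ρ t
  bound = subT (liftS ⌜ ρ ⌝) (wkT t)
  Δ = (var zero ⊑ bound) ∷ map wkF Γ

  bound≐α : Δ ⊩ bound ≐ biteral α
  bound≐α = cast (cong (_≐ biteral α) bound≡) (subT⌜⌝≐evalT ρ t)
    where
    bound≡ : subT ⌜ ρ ⌝ t ≡ bound
    bound≡ = trans (sym (subT-renT (var zero ∷ₛ ⌜ ρ ⌝) suc t)) (subT-cong (liftS-⌜⌝ ρ) (wkT t))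

  x-cases : Δ ⊩ ⋁ (map (λ β → var zero ≐ biteral β) (upTo α))
  x-cases = ⇒E (⊑biteral⇒⋁≐ α (var zero)) (⊑-congʳ bound≐α (hyp (here refl)))

  branch : ∀ {β} → β ∈ upTo α → ∀ {Δ'} → Δ' ⊩ var zero ≐ biteral β → Δ' ⊩ subF (liftS ⌜ ρ ⌝) φ
  branch {β} β∈ x≐β = ≐subst-≡ (subF (liftS ⌜ ρ ⌝) φ)
    (trans (subF-liftS-inst ⌜ ρ ⌝ (biteral β) φ) (sym (subF-⌜∷ₑ⌝ β ρ φ)))
    (trans (subF-liftS-inst ⌜ ρ ⌝ (var zero) φ) (subF-cong (liftS-⌜⌝ ρ) φ))
    (≐sym x≐β) (instances β (∈upTo⇒length≤ α β∈))

evalT-wkT : ∀ {n} a (ρ : Env n) t → evalT (a ∷ₑ ρ) (wkT t) ≡ evalT ρ t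
evalT-wkT a ρ (var i)  = refl
evalT-wkT a ρ e        = refl
evalT-wkT a ρ c0       = refl
evalT-wkT a ρ c1       = refl
evalT-wkT a ρ (s ∘ₜ t) = cong₂ _++_ (evalT-wkT a ρ s) (evalT-wkT a ρ t)

Σ-complete : ∀ {n} {φ : Fm n} → IsΣ φ → (ρ : Env n) → Sat ρ φ →
             ∀ {m} {Γ : List (Fm m)} → Γ ⊩ subF ⌜ ρ ⌝ φ
Σ-complete (σ⊑ s t)  ρ s⊑t = ⊑-complete s t ρ s⊑t
Σ-complete (σ¬⊑ s t) ρ s⋢t =
  ⇒I (biteral-⋢ (evalT ρ s) (evalT ρ t) (≰⇒> s⋢t) (⊑-cong (subT⌜⌝≐evalT ρ s) (subT⌜⌝≐evalT ρ t) (hyp (here refl))))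
Σ-complete (σ≐ s t)  ρ s≡t =
  ≐trans (subT⌜⌝≐evalT ρ s) (≐trans (≡⇒≐ (cong biteral s≡t)) (≐sym (subT⌜⌝≐evalT ρ t)))
Σ-complete (σ¬≐ s t) ρ s≢t =
  ⇒I (biteral-≢ (evalT ρ s) (evalT ρ t) s≢t (≐trans (≐sym (subT⌜⌝≐evalT ρ s)) (≐trans (hyp (here refl)) (subT⌜⌝≐evalT ρ t))))
Σ-complete (σ∧ p q) ρ (φ-true , ψ-true) = ∧I (Σ-complete p ρ φ-true) (Σ-complete q ρ ψ-true)
Σ-complete (σ∨ p q) ρ (inj₁ φ-true) = ∨I₁ (Σ-complete p ρ φ-true)
Σ-complete (σ∨ p q) ρ (inj₂ ψ-true) = ∨I₂ (Σ-complete q ρ ψ-true)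
Σ-complete (σ∃ {φ = φ} p) ρ (a , φ-true) = ∃-intro ρ a φ (Σ-complete p (a ∷ₑ ρ) φ-true)
Σ-complete (σ∃⊑ t {φ} p) ρ (a , a⊑t , φ-true) = ∃-intro ρ a ((var zero ⊑ wkT t) ∧̇ φ)
  (∧I (⊑-complete (var zero) (wkT t) (a ∷ₑ ρ) a⊑t) (Σ-complete p (a ∷ₑ ρ) φ-true))
Σ-complete (σ∀⊑ t {φ} p) ρ φ-true = ∀⊑-intro ρ t φ λ β β⊑t →
  Σ-complete p (β ∷ₑ ρ) (φ-true β (subst (λ γ → length β ≤ length γ) (sym (evalT-wkT β ρ t)) β⊑t))

theorem7 : (φ : Sentence) → IsΣ φ → 𝔉⊨ φ → F'⊢ φ
theorem7 φ p 𝔉⊨φ = cast (subF-id (λ ()) φ) (Σ-complete p emptyEnv 𝔉⊨φ)
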